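{- Let $V$ be a finite set with $|V|=n$ and let $\Sigma$ be a set of permutations of $V$. If $\Sigma$ is closed under splicing, then $\Sigma$ is well-founded and $\mathcal{F}^\Sigma$ is closed under union.
   Context: For a permutation $\sigma$ of $V$, its initial sets are $S^\sigma_j$, the set of its first $j$ elements, $j=0,\dots,n$. $\mathcal{F}^\Sigma$ is the family of all initial sets of all $\sigma\in\Sigma$. An $\mathcal{F}^\Sigma$-chain is a sequence $\emptyset=S_0\subsetneq S_1\subsetneq\cdots\subsetneq S_k=V$ of sets in $\mathcal{F}^\Sigma$. A permutation is consistent with such a chain if every set in it is an initial set of the permutation; $\Sigma$ is well-founded if every $\mathcal{F}^\Sigma$-chain is consistent with some $\sigma\in\Sigma$. For permutations $\sigma,\tau$ and $1\le j\le n$, the splice $\pi_j(\sigma,\tau)$ is the permutation that takes the first $j$ elements of $\sigma$ in order and then the remaining elements of $V$ in the order in which they appear in $\tau$. $\Sigma$ is closed under splicing if $\pi_j(\sigma,\tau)\in\Sigma$ for all $\sigma,\tau\in\Sigma$ and $1\le j\le n$. -}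

module Defs where

open import Data.Nat using (ℕ; zero; suc; _≤_; _<_)
open import Data.Fin using (Fin)
open import Data.Fin.Properties using (_≟_)
open import Data.Fin.Subset using (Subset; ⁅_⁆; _∪_; _⊂_)
import Data.Fin.Subset as Sub
open import Data.List using (List; take; filter; allFin; foldr; _++_)
open import Data.List.Relation.Binary.Permutation.Propositional using (_↭_)
open import Data.Product using (Σ; ∃; _×_)
open import Relation.Binary.PropositionalEquality using (_≡_)
open import Relation.Nullary using (¬?)

-- Ground set V = Fin n (any finite set with |V| = n).
-- A permutation of V is an ordering of V, i.e. a list of all elements
-- of V each appearing exactly once (a rearrangement of allFin n).
IsPerm : {n : ℕ} → List (Fin n) → Set
IsPerm {n} σ = σ ↭ allFin n

record PermSet (n : ℕ) : Set₁ where
  field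
    mem    : List (Fin n) → Set
    isPerm : ∀ σ → mem σ → IsPerm σ
open PermSet public

toSubset : {n : ℕ} → List (Fin n) → Subset n
toSubset = foldr (λ x s → ⁅ x ⁆ ∪ s) Sub.⊥

initSet : {n : ℕ} → List (Fin n) → ℕ → Subset n
initSet σ j = toSubset (take j σ)

import Data.List.Membership.DecPropositional as DecMem

splice : {n : ℕ} → ℕ → List (Fin n) → List (Fin n) → List (Fin n)
splice {n} j σ τ = take j σ ++ filter (λ x → ¬? (x ∈? take j σ)) τ
  where open DecMem (_≟_ {n}) using (_∈?_)

InF : {n : ℕ} → PermSet n → Subset n → Set
InF {n} Sg S = Σ (List (Fin n)) λ σ → mem Sg σ × ∃ λ j → j ≤ n × S ≡ initSet σ j

-- An F^Σ-chain ∅ = S_0 ⊊ S_1 ⊊ ... ⊊ S_k = V, given by k and S : ℕ → Subset n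
-- (only S_0..S_k matter).
IsChain : {n : ℕ} → PermSet n → (k : ℕ) → (ℕ → Subset n) → Set
IsChain Sg k S =
  (S 0 ≡ Sub.⊥) × (S k ≡ Sub.⊤)
  × (∀ i → i < k → S i ⊂ S (suc i))
  × (∀ i → i ≤ k → InF Sg (S i))

ConsistentWith : {n : ℕ} → List (Fin n) → (k : ℕ) → (ℕ → Subset n) → Set
ConsistentWith {n} σ k S = ∀ i → i ≤ k → ∃ λ j → j ≤ n × S i ≡ initSet σ j

WellFounded : {n : ℕ} → PermSet n → Set
WellFounded {n} Sg = ∀ k S → IsChain Sg k S →
  Σ (List (Fin n)) λ σ → mem Sg σ × ConsistentWith σ k S

ClosedUnderSplicing : {n : ℕ} → PermSet n → Set
ClosedUnderSplicing {n} Sg = ∀ σ τ → mem Sg σ → mem Sg τ →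
  ∀ j → 1 ≤ j → j ≤ n → mem Sg (splice j σ τ)

FClosedUnderUnion : {n : ℕ} → PermSet n → Set
FClosedUnderUnion Sg = ∀ S T → InF Sg S → InF Sg T → InF Sg (S ∪ T)

-- Splicing ρ after its first m elements with σ yields a permutation of Σ
-- whose initial sets are those of ρ up to m, followed by (initSet ρ m ∪
-- initSet σ j) for every j.  This gives union-closure at once, and for a
-- chain S_0 ⊆ … ⊆ S_k it lets us grow, one step at a time, a permutation of
-- Σ consistent with S_0, …, S_i: splice the current one after S_i with a
-- permutation having S_{i+1} as an initial set.
module Submission where

open import Defs
open import Data.Nat using (ℕ; zero; suc; _≤_; _<_; _⊓_; z≤n; s≤s)
open import Data.Nat.Properties
  using (≤-refl; ≤-trans; ≤-total; m≤n⇒m⊓n≡m; m≥n⇒m⊓n≡n; m⊓n≤n; m≤n⇒m<n∨m≡n; <⇒≤)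
open import Data.Product using (_×_; _,_; proj₁; Σ; ∃)
open import Data.Sum using (inj₁; inj₂; [_,_])
open import Data.Fin using (Fin)
open import Data.Fin.Properties using (_≟_)
open import Data.Fin.Subset using (Subset; ⁅_⁆; _∪_; _⊆_; _∈_)
open import Data.Fin.Subset.Properties
  using (⊆-antisym; ⊆-refl; ⊆-trans; p⊆p∪q; q⊆p∪q; x∈p∪q⁻; x∈p∪q⁺; x∈⁅x⁆; x∈⁅y⁆⇒x≡y; ∉⊥; ∪-identityˡ; ∪-assoc)
open import Data.List using (List; []; _∷_; take; drop; filter; length; _++_)
open import Data.List.Properties
  using (length-++-≤ˡ; take++drop≡id; filter-++; length-tabulate; length-take; take-take; ++-assoc)
open import Data.List.Relation.Unary.Any using (here; there)
import Data.List.Membership.Propositional as List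
open import Data.List.Membership.Propositional.Properties using (∈-filter⁺; ∈-filter⁻)
open import Data.List.Relation.Binary.Permutation.Propositional.Properties using (↭-length)
import Data.List.Membership.DecPropositional as DecMem
open import Data.Empty using (⊥-elim)
open import Relation.Binary.PropositionalEquality using (_≡_; refl; sym; trans; cong; cong₂; subst; subst₂; module ≡-Reasoning)
open import Relation.Nullary using (¬?; yes; no)
open import Function using (id)

module _ {A : Set} where

  take-length-++ : ∀ (xs ys : List A) → take (length xs) (xs ++ ys) ≡ xs
  take-length-++ []       ys = refl
  take-length-++ (x ∷ xs) ys = cong (x ∷_) (take-length-++ xs ys)

  take-++ˡ : ∀ a (xs ys : List A) → a ≤ length xs → take a (xs ++ ys) ≡ take a xs
  take-++ˡ zero    xs       ys _         = refl
  take-++ˡ (suc a) (x ∷ xs) ys (s≤s a≤) = cong (x ∷_) (take-++ˡ a xs ys a≤)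

p⊆q⇒p∪q≡q : ∀ {n} {p q : Subset n} → p ⊆ q → p ∪ q ≡ q
p⊆q⇒p∪q≡q {p = p} {q} p⊆q = ⊆-antisym (λ x∈ → [ p⊆q , id ] (x∈p∪q⁻ p q x∈)) (q⊆p∪q p q)

⊆-chain-mono : ∀ {n k} {S : ℕ → Subset n} → (∀ i → i < k → S i ⊆ S (suc i)) →
  ∀ {l} i → l ≤ i → i ≤ k → S l ⊆ S i
⊆-chain-mono step zero    z≤n _ = ⊆-refl
⊆-chain-mono step (suc i) l≤ i<k with m≤n⇒m<n∨m≡n l≤
... | inj₂ refl      = ⊆-refl
... | inj₁ (s≤s l≤i) = ⊆-trans (⊆-chain-mono step i l≤i (<⇒≤ i<k)) (step i i<k)

module _ {n : ℕ} where
  open DecMem (_≟_ {n}) using (_∈?_)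

  Initial : List (Fin n) → Subset n → Set
  Initial σ S = ∃ λ j → j ≤ n × S ≡ initSet σ j

  ∈-toSubset⁺ : ∀ {x : Fin n} {xs} → x List.∈ xs → x ∈ toSubset xs
  ∈-toSubset⁺ {x} (here refl) = p⊆p∪q _ (x∈⁅x⁆ x)
  ∈-toSubset⁺ (there x∈)      = q⊆p∪q _ _ (∈-toSubset⁺ x∈)

  ∈-toSubset⁻ : ∀ {x : Fin n} xs → x ∈ toSubset xs → x List.∈ xs
  ∈-toSubset⁻ []       x∈ = ⊥-elim (∉⊥ x∈)
  ∈-toSubset⁻ (y ∷ xs) x∈ with x∈p∪q⁻ ⁅ y ⁆ (toSubset xs) x∈
  ... | inj₁ x∈y  = here (x∈⁅y⁆⇒x≡y y x∈y)
  ... | inj₂ x∈xs = there (∈-toSubset⁻ xs x∈xs)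

  toSubset-++ : ∀ (xs ys : List (Fin n)) → toSubset (xs ++ ys) ≡ toSubset xs ∪ toSubset ys
  toSubset-++ []       ys = sym (∪-identityˡ (toSubset ys))
  toSubset-++ (x ∷ xs) ys = trans (cong (⁅ x ⁆ ∪_) (toSubset-++ xs ys)) (sym (∪-assoc ⁅ x ⁆ _ _))

  toSubset-∪-filter-∉ : ∀ (xs ys : List (Fin n)) →
    toSubset xs ∪ toSubset (filter (λ x → ¬? (x ∈? xs)) ys) ≡ toSubset xs ∪ toSubset ys
  toSubset-∪-filter-∉ xs ys = ⊆-antisym ⊆-from ⊆-to
    where
    P = λ x → ¬? (x ∈? xs)

    ⊆-from : toSubset xs ∪ toSubset (filter P ys) ⊆ toSubset xs ∪ toSubset ys
    ⊆-from x∈ with x∈p∪q⁻ _ _ x∈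
    ... | inj₁ x∈xs = x∈p∪q⁺ (inj₁ x∈xs)
    ... | inj₂ x∈fs with ∈-filter⁻ P {xs = ys} (∈-toSubset⁻ (filter P ys) x∈fs)
    ...   | x∈ys , _ = x∈p∪q⁺ (inj₂ (∈-toSubset⁺ x∈ys))

    ⊆-to : toSubset xs ∪ toSubset ys ⊆ toSubset xs ∪ toSubset (filter P ys)
    ⊆-to {x} x∈ with x∈p∪q⁻ _ _ x∈ | x ∈? xs
    ... | inj₁ x∈xs | _       = x∈p∪q⁺ (inj₁ x∈xs)
    ... | inj₂ _    | yes x∈xs = x∈p∪q⁺ (inj₁ (∈-toSubset⁺ x∈xs))
    ... | inj₂ x∈ys | no x∉xs  = x∈p∪q⁺ (inj₂ (∈-toSubset⁺ (∈-filter⁺ P (∈-toSubset⁻ ys x∈ys) x∉xs)))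

  toSubset-take⊆ : ∀ a (xs : List (Fin n)) → toSubset (take a xs) ⊆ toSubset xs
  toSubset-take⊆ a xs x∈ = subst (_ ∈_)
    (trans (sym (toSubset-++ (take a xs) (drop a xs))) (cong toSubset (take++drop≡id a xs)))
    (p⊆p∪q _ x∈)

  initSet-mono : ∀ (σ : List (Fin n)) {a b} → a ≤ b → initSet σ a ⊆ initSet σ b
  initSet-mono σ {a} {b} a≤b = subst (λ xs → toSubset xs ⊆ initSet σ b)
    (trans (take-take a b σ) (cong (λ c → take c σ) (m≤n⇒m⊓n≡m a≤b)))
    (toSubset-take⊆ a (take b σ))

  initSet-⊓ : ∀ (σ : List (Fin n)) a m → initSet σ a ⊆ initSet σ m → initSet σ a ≡ initSet σ (a ⊓ m)
  initSet-⊓ σ a m ⊆m with ≤-total a m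
  ... | inj₁ a≤m rewrite m≤n⇒m⊓n≡m a≤m = refl
  ... | inj₂ m≤a rewrite m≥n⇒m⊓n≡n m≤a = ⊆-antisym ⊆m (initSet-mono σ m≤a)

  initSet-splice : ∀ (ρ σ : List (Fin n)) {a m} → a ≤ m → m ≤ length ρ →
    initSet (splice m ρ σ) a ≡ initSet ρ a
  initSet-splice ρ σ {a} {m} a≤m m≤ρ = cong toSubset (begin
    take a (take m ρ ++ _)  ≡⟨ take-++ˡ a (take m ρ) _ a≤length ⟩
    take a (take m ρ)       ≡⟨ take-take a m ρ ⟩
    take (a ⊓ m) ρ          ≡⟨ cong (λ c → take c ρ) (m≤n⇒m⊓n≡m a≤m) ⟩
    take a ρ                ∎)
    where
    open ≡-Reasoning
    a≤length : a ≤ length (take m ρ)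
    a≤length = subst (a ≤_) (sym (trans (length-take m ρ) (m≤n⇒m⊓n≡m m≤ρ))) a≤m

  initial-splice-∪ : ∀ (ρ σ : List (Fin n)) m j → length (splice m ρ σ) ≡ n →
    Initial (splice m ρ σ) (initSet ρ m ∪ initSet σ j)
  initial-splice-∪ ρ σ m j length≡n =
    length (A ++ F) , bound , sym (begin
      toSubset (take (length (A ++ F)) (A ++ filter P σ))
        ≡⟨ cong (λ zs → toSubset (take (length (A ++ F)) (A ++ zs))) filter-split ⟩
      toSubset (take (length (A ++ F)) (A ++ F ++ R))
        ≡⟨ cong (λ zs → toSubset (take (length (A ++ F)) zs)) (sym (++-assoc A F R)) ⟩
      toSubset (take (length (A ++ F)) ((A ++ F) ++ R))
        ≡⟨ cong toSubset (take-length-++ (A ++ F) R) ⟩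
      toSubset (A ++ F)
        ≡⟨ toSubset-++ A F ⟩
      toSubset A ∪ toSubset F
        ≡⟨ toSubset-∪-filter-∉ A (take j σ) ⟩
      initSet ρ m ∪ initSet σ j ∎)
    where
    open ≡-Reasoning
    A = take m ρ
    P = λ x → ¬? (x ∈? A)
    F = filter P (take j σ)
    R = filter P (drop j σ)

    filter-split : filter P σ ≡ F ++ R
    filter-split = trans (cong (filter P) (sym (take++drop≡id j σ))) (filter-++ P (take j σ) (drop j σ))

    bound : length (A ++ F) ≤ n
    bound = subst (length (A ++ F) ≤_)
      (trans (cong length (trans (++-assoc A F R) (cong (A ++_) (sym filter-split)))) length≡n)
      (length-++-≤ˡ (A ++ F))

module _ {n : ℕ} (Sg : PermSet n) (closed : ClosedUnderSplicing Sg) where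

  length-member : ∀ σ → mem Sg σ → length σ ≡ n
  length-member σ σ∈ = trans (↭-length (isPerm Sg σ σ∈)) (length-tabulate id)

  -- Splicing after 0 elements is not allowed, but for m = 0 σ itself will do.
  merge : ∀ {ρ σ} → mem Sg ρ → mem Sg σ → ∀ {m j} → m ≤ n → j ≤ n →
    Σ (List (Fin n)) λ ρ′ → mem Sg ρ′
      × (∀ a → a ≤ m → initSet ρ′ a ≡ initSet ρ a)
      × Initial ρ′ (initSet ρ m ∪ initSet σ j)
  merge {ρ} {σ} ρ∈ σ∈ {zero} {j} _ j≤n =
    σ , σ∈ , (λ { .zero z≤n → refl }) ,
    j , j≤n , ∪-identityˡ (initSet σ j)
  merge {ρ} {σ} ρ∈ σ∈ {suc m} {j} m≤n _ =
    splice (suc m) ρ σ , spliced∈ ,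
    (λ a a≤m → initSet-splice ρ σ a≤m (subst (suc m ≤_) (sym (length-member ρ ρ∈)) m≤n)) ,
    initial-splice-∪ ρ σ (suc m) j (length-member _ spliced∈)
    where
    spliced∈ : mem Sg (splice (suc m) ρ σ)
    spliced∈ = closed ρ σ ρ∈ σ∈ (suc m) (s≤s z≤n) m≤n

  ∪-closed : FClosedUnderUnion Sg
  ∪-closed _ _ (σ , σ∈ , i , i≤n , refl) (τ , τ∈ , j , j≤n , refl) with merge σ∈ τ∈ i≤n j≤n
  ... | ρ′ , ρ′∈ , _ , initial = ρ′ , ρ′∈ , initial

  consistent-prefix : ∀ {k} {S : ℕ → Subset n} →
    (∀ i → i < k → S i ⊆ S (suc i)) → (∀ i → i ≤ k → InF Sg (S i)) →
    ∀ i → i ≤ k → Σ (List (Fin n)) λ ρ → mem Sg ρ × ConsistentWith ρ i S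
  consistent-prefix step inF zero 0≤k with inF zero 0≤k
  ... | σ , σ∈ , initial = σ , σ∈ , λ { .zero z≤n → initial }
  consistent-prefix {S = S} step inF (suc i) i<k
    with consistent-prefix step inF i (<⇒≤ i<k) | inF (suc i) i<k
  ... | ρ , ρ∈ , consistent | σ , σ∈ , j , j≤n , Sᵢ₊₁≡
    with consistent i ≤-refl
  ... | m , m≤n , Sᵢ≡
    with merge ρ∈ σ∈ m≤n j≤n
  ... | ρ′ , ρ′∈ , agrees , initial = ρ′ , ρ′∈ , consistent′
    where
    Sᵢ₊₁-as-∪ : S (suc i) ≡ initSet ρ m ∪ initSet σ j
    Sᵢ₊₁-as-∪ = trans (sym (p⊆q⇒p∪q≡q (step i i<k))) (cong₂ _∪_ Sᵢ≡ Sᵢ₊₁≡)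

    consistent′ : ConsistentWith ρ′ (suc i) S
    consistent′ l l≤ with m≤n⇒m<n∨m≡n l≤
    ... | inj₂ refl = subst (Initial ρ′) (sym Sᵢ₊₁-as-∪) initial
    ... | inj₁ (s≤s l≤i) with consistent l l≤i
    ... | a , _ , Sₗ≡ = a ⊓ m , ≤-trans (m⊓n≤n a m) m≤n , (begin
      S l               ≡⟨ Sₗ≡ ⟩
      initSet ρ a       ≡⟨ initSet-⊓ ρ a m (subst₂ _⊆_ Sₗ≡ Sᵢ≡ (⊆-chain-mono step i l≤i (<⇒≤ i<k))) ⟩
      initSet ρ (a ⊓ m) ≡⟨ sym (agrees (a ⊓ m) (m⊓n≤n a m)) ⟩
      initSet ρ′ (a ⊓ m) ∎)
      where open ≡-Reasoning

lemma3 : (n : ℕ) (Sg : PermSet n) → ClosedUnderSplicing Sg →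
    WellFounded Sg × FClosedUnderUnion Sg
lemma3 n Sg closed = wellFounded , ∪-closed Sg closed
  where
  wellFounded : WellFounded Sg
  wellFounded k S (_ , _ , strict , inF) =
    consistent-prefix Sg closed (λ i i<k → proj₁ (strict i i<k)) inF k ≤-refl
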